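{- Suppose $X\subseteq T$ has an enumeration $X=\{t_k:k\in\omega\}$ such that $\ell(t_k)\ge k$ for all $k\in\omega$. Then $X\in\mathcal N_T$.
   Context: $T={}^{\omega>}2$ is the set of finite binary sequences; $\ell(t)$ is the length of $t$. For $f\in{}^\omega2$, $B(f)=\{f\restriction n:n\in\omega\}$; for $X\subseteq T$, $\lfloor X\rfloor=\{f\in{}^\omega2:|B(f)\cap X|=\aleph_0\}$. $\mathcal N_T$ is the set of infinite $X\subseteq T$ with $\sigma(\lfloor X\rfloor)=0$, $\sigma$ the product fair-coin measure on ${}^\omega2$. -}

module Defs where

open import Data.Bool using (Bool)
open import Data.List using (List; []; _∷_; length)
open import Data.List.Membership.Propositional using (_∈_)
open import Data.Nat using (ℕ; zero; suc; _≤_)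
open import Data.Product using (Σ; ∃; _×_)
open import Data.Rational using (ℚ; 0ℚ; 1ℚ; ½; _+_; _*_; _<_) renaming (_≤_ to _≤ℚ_)
open import Relation.Binary.PropositionalEquality using (_≡_)
open import Relation.Nullary using (¬_)

T : Set
T = List Bool

ℓ : T → ℕ
ℓ = length

Cantor : Set
Cantor = ℕ → Bool

_↾_ : Cantor → ℕ → T
f ↾ zero = []
f ↾ suc n = f 0 ∷ ((λ i → f (suc i)) ↾ n)

SubT : Set₁
SubT = T → Set

SubC : Set₁
SubC = Cantor → Set

FiniteT : SubT → Set
FiniteT X = Σ (List T) λ L → ∀ s → X s → s ∈ L

InfiniteT : SubT → Set
InfiniteT X = ¬ FiniteT X

-- ⌊X⌋ : f such that infinitely many initial segments f↾n lie in X
-- (B(f) ∩ X is infinite iff {n : f↾n ∈ X} is unbounded, since f↾n are pairwise distinct)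
⌊_⌋ : SubT → SubC
⌊ X ⌋ f = ∀ n → Σ ℕ λ m → n ≤ m × X (f ↾ m)

_≺_ : T → Cantor → Set
s ≺ f = f ↾ ℓ s ≡ s

μ : T → ℚ
μ [] = 1ℚ
μ (_ ∷ s) = ½ * μ s

psum : (ℕ → ℚ) → ℕ → ℚ
psum a zero = 0ℚ
psum a (suc n) = psum a n + a n

σNull : SubC → Set
σNull A = ∀ (ε : ℚ) → 0ℚ < ε →
  Σ (ℕ → T) λ c → (∀ f → A f → ∃ λ i → c i ≺ f) × (∀ n → psum (λ i → μ (c i)) n ≤ℚ ε)

∈𝒩T : SubT → Set
∈𝒩T X = InfiniteT X × σNull ⌊ X ⌋

-- X is infinite because its elements have unbounded lengths. If f has infinitely many
-- prefixes in X, then, since t 0, …, t N are finitely many, one of them is some t k with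
-- k > N; so the cylinders [t k], k > N, cover ⌊X⌋, and their measures are at most
-- 2^-k by the length hypothesis, summing to at most 2^-N.
module Submission where

open import Defs
open import Data.Nat using (ℕ; _≤_)
open import Data.Product using (∃)
open import Relation.Binary.PropositionalEquality using (_≡_)

open import Data.List using (List; []; _∷_; applyUpTo)
open import Data.List.Membership.Propositional using (_∈_)
open import Data.List.Membership.Propositional.Properties using (∈-applyUpTo⁺)
open import Data.List.Relation.Unary.Any using (here; there)
open import Data.Nat as ℕ using (zero; suc; s≤s; _<_; _⊔_; _∸_)
import Data.Nat.Properties as ℕ
open import Data.Integer using (+_; -[1+_]; +≤+; +<+)
open import Data.Product using (_×_; _,_)
open import Data.Rational as ℚ using (ℚ; mkℚ; 0ℚ; 1ℚ; ½; toℚᵘ) renaming (_≤_ to _≤ℚ_)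
import Data.Rational.Properties as ℚ
open import Data.Rational.Unnormalised as ℚᵘ using (mkℚᵘ; *≤*)
import Data.Rational.Unnormalised.Properties as ℚᵘ
open import Relation.Binary.PropositionalEquality using (refl; sym; trans; cong; subst; subst₂)

½^_ : ℕ → ℚ
½^ zero = 1ℚ
½^ suc n = ½ ℚ.* (½^ n)

½^-nonNeg : ∀ n → 0ℚ ≤ℚ ½^ n
½^-nonNeg zero = ℚ.nonNegative⁻¹ 1ℚ
½^-nonNeg (suc n) = ℚ.*-monoˡ-≤-nonNeg ½ (½^-nonNeg n)

½^≤1 : ∀ n → ½^ n ≤ℚ 1ℚ
½^≤1 zero = ℚ.≤-refl
½^≤1 (suc n) = ℚ.≤-trans (ℚ.*-monoˡ-≤-nonNeg ½ (½^≤1 n)) (ℚ.*≤* (+≤+ (s≤s ℕ.z≤n)))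

½^-antitone : ∀ {m n} → m ≤ n → ½^ n ≤ℚ ½^ m
½^-antitone {n = n} ℕ.z≤n = ½^≤1 n
½^-antitone (s≤s m≤n) = ℚ.*-monoˡ-≤-nonNeg ½ (½^-antitone m≤n)

½^-halves : ∀ n → ½^ suc n ℚ.+ ½^ suc n ≡ ½^ n
½^-halves n = trans (sym (ℚ.*-distribʳ-+ (½^ n) ½ ½)) (ℚ.*-identityˡ (½^ n))

μ≡½^ℓ : ∀ s → μ s ≡ ½^ ℓ s
μ≡½^ℓ [] = refl
μ≡½^ℓ (_ ∷ s) = cong (½ ℚ.*_) (μ≡½^ℓ s)

-- mkℚᵘ (+ 1) n is 1/(n+1).
½^≤1/suc : ∀ n → toℚᵘ (½^ n) ℚᵘ.≤ mkℚᵘ (+ 1) n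
½^≤1/suc zero = ℚᵘ.≤-refl
½^≤1/suc (suc n) = ℚᵘ.≤-trans
  (ℚᵘ.≤-reflexive (ℚ.toℚᵘ-homo-* ½ (½^ n)))
  (ℚᵘ.≤-trans (ℚᵘ.*-monoʳ-≤-nonNeg ℚᵘ.½ (½^≤1/suc n)) half-of-1/suc)
  where
  half-of-1/suc : ℚᵘ.½ ℚᵘ.* mkℚᵘ (+ 1) n ℚᵘ.≤ mkℚᵘ (+ 1) (suc n)
  half-of-1/suc = *≤* (+≤+ (s≤s (subst₂ _≤_
    (cong suc (sym (ℕ.+-identityʳ n)))
    (sym (trans (ℕ.+-identityʳ _) (cong (n ℕ.+_) (ℕ.+-identityʳ _))))
    (ℕ.m≤n+m (suc n) n))))

½^-eventually-≤ : ∀ ε → 0ℚ ℚ.< ε → ∃ λ N → ½^ N ≤ℚ ε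
½^-eventually-≤ (mkℚ (+ zero) d _) (ℚ.*<* (+<+ ()))
½^-eventually-≤ (mkℚ -[1+ _ ] d _) (ℚ.*<* ())
½^-eventually-≤ (mkℚ (+ suc p) d _) _ = d , ℚ.toℚᵘ-cancel-≤
  (ℚᵘ.≤-trans (½^≤1/suc d) (*≤* (+≤+ (s≤s (ℕ.+-monoʳ-≤ d ℕ.z≤n)))))

module _ (a : ℕ → ℚ) (N : ℕ) (a≤½^ : ∀ i → a i ≤ℚ ½^ suc (N ℕ.+ i)) where

  psum-+-½^-≤ : ∀ n → psum a n ℚ.+ ½^ (N ℕ.+ n) ≤ℚ ½^ N
  psum-+-½^-≤ zero = ℚ.≤-reflexive (trans (ℚ.+-identityˡ _) (cong ½^_ (ℕ.+-identityʳ N)))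
  psum-+-½^-≤ (suc n) = begin
    psum a n ℚ.+ a n ℚ.+ ½^ (N ℕ.+ suc n)    ≡⟨ cong (λ k → psum a n ℚ.+ a n ℚ.+ ½^ k) (ℕ.+-suc N n) ⟩
    psum a n ℚ.+ a n ℚ.+ ½^ suc (N ℕ.+ n)    ≡⟨ ℚ.+-assoc (psum a n) (a n) _ ⟩
    psum a n ℚ.+ (a n ℚ.+ ½^ suc (N ℕ.+ n))  ≤⟨ ℚ.+-monoʳ-≤ (psum a n) (ℚ.+-monoˡ-≤ _ (a≤½^ n)) ⟩
    psum a n ℚ.+ (½^ suc (N ℕ.+ n) ℚ.+ ½^ suc (N ℕ.+ n))  ≡⟨ cong (psum a n ℚ.+_) (½^-halves (N ℕ.+ n)) ⟩
    psum a n ℚ.+ ½^ (N ℕ.+ n)                ≤⟨ psum-+-½^-≤ n ⟩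
    ½^ N                                     ∎
    where open ℚ.≤-Reasoning

  psum-≤-½^ : ∀ n → psum a n ≤ℚ ½^ N
  psum-≤-½^ n = begin
    psum a n                    ≡⟨ sym (ℚ.+-identityʳ (psum a n)) ⟩
    psum a n ℚ.+ 0ℚ             ≤⟨ ℚ.+-monoʳ-≤ (psum a n) (½^-nonNeg (N ℕ.+ n)) ⟩
    psum a n ℚ.+ ½^ (N ℕ.+ n)  ≤⟨ psum-+-½^-≤ n ⟩
    ½^ N                        ∎
    where open ℚ.≤-Reasoning

ℓ-↾ : ∀ f m → ℓ (f ↾ m) ≡ m
ℓ-↾ f zero = refl
ℓ-↾ f (suc m) = cong suc (ℓ-↾ (λ i → f (suc i)) m)

↾-≺ : ∀ f m → (f ↾ m) ≺ f
↾-≺ f m = cong (f ↾_) (ℓ-↾ f m)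

length-bound : ∀ (L : List T) → ∃ λ b → ∀ {s} → s ∈ L → ℓ s < b
length-bound [] = 0 , λ ()
length-bound (s ∷ L) with length-bound L
... | b , ℓ<b = suc (ℓ s) ⊔ b , λ
  { (here refl) → ℕ.m≤m⊔n (suc (ℓ s)) b
  ; (there s∈L) → ℕ.≤-trans (ℓ<b s∈L) (ℕ.m≤n⊔m (suc (ℓ s)) b)
  }

unbounded⇒infinite : (X : SubT) → (∀ b → ∃ λ s → X s × b ≤ ℓ s) → InfiniteT X
unbounded⇒infinite X unbounded (L , X⊆L) with length-bound L
... | b , ℓ<b with unbounded b
...   | s , Xs , b≤ℓs = ℕ.<⇒≱ (ℓ<b (X⊆L s Xs)) b≤ℓs

⌊⌋-covered-by-tail : (X : SubT) (t : ℕ → T) → (∀ s → X s → ∃ λ k → t k ≡ s) →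
  ∀ N f → ⌊ X ⌋ f → ∃ λ i → t (suc N ℕ.+ i) ≺ f
⌊⌋-covered-by-tail X t X⊆t N f f∈⌊X⌋ with length-bound (applyUpTo t (suc N))
... | b , ℓ<b with f∈⌊X⌋ b
...   | m , b≤m , Xf↾m with X⊆t (f ↾ m) Xf↾m
...     | k , tk≡f↾m = k ∸ suc N , subst (_≺ f) (sym tail≡f↾m) (↾-≺ f m)
  where
  N<k : N < k
  N<k = ℕ.≰⇒> λ k≤N → ℕ.<⇒≱
    (subst (_< b) (trans (cong ℓ tk≡f↾m) (ℓ-↾ f m)) (ℓ<b (∈-applyUpTo⁺ t (s≤s k≤N))))
    b≤m

  tail≡f↾m : t (suc N ℕ.+ (k ∸ suc N)) ≡ f ↾ m
  tail≡f↾m = trans (cong t (ℕ.m+[n∸m]≡n N<k)) tk≡f↾m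

lemma3p4 : (X : SubT) (t : ℕ → T) →
    (∀ s → X s → ∃ λ k → t k ≡ s) → (∀ k → X (t k)) →
    (∀ k → k ≤ ℓ (t k)) →
    ∈𝒩T X
lemma3p4 X t X⊆t t∈X k≤ℓ = unbounded⇒infinite X (λ b → t b , t∈X b , k≤ℓ b) , null
  where
  null : σNull ⌊ X ⌋
  null ε ε>0 with ½^-eventually-≤ ε ε>0
  ... | N , ½^N≤ε = tail , ⌊⌋-covered-by-tail X t X⊆t N , λ n → ℚ.≤-trans (psum-≤-½^ _ N μ-tail≤ n) ½^N≤ε
    where
    tail : ℕ → T
    tail i = t (suc N ℕ.+ i)

    μ-tail≤ : ∀ i → μ (tail i) ≤ℚ ½^ suc (N ℕ.+ i)
    μ-tail≤ i = subst (_≤ℚ ½^ suc (N ℕ.+ i)) (sym (μ≡½^ℓ (tail i))) (½^-antitone (k≤ℓ (suc N ℕ.+ i)))
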